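{- Let $n,r,v,e$ be positive integers with $e\ge 2$, and write $er=v+p(e-1)+q$ with integers $p$ and $1\le q\le e-1$. Then $$f_r(n,v,e)\le q\binom{n}{p+1}\Big/\binom{r}{p+1}+(e-1-q)\binom{n}{p}\Big/\binom{r}{p}.$$ Equivalently, $$f_r(n,v,e)\le q\binom{n}{\lceil\frac{er-v}{e-1}\rceil}\Big/\binom{r}{\lceil\frac{er-v}{e-1}\rceil}+(e-1-q)\binom{n}{\lfloor\frac{er-v}{e-1}\rfloor}\Big/\binom{r}{\lfloor\frac{er-v}{e-1}\rfloor}.$$
   Context: For integers $r,v,e$, an $r$-uniform hypergraph is called $\mathcal{G}_r(v,e)$-free if the union of any $e$ distinct edges has at least $v+1$ vertices. $f_r(n,v,e)$ denotes the maximum number of edges in a $\mathcal{G}_r(v,e)$-free $r$-uniform hypergraph on $n$ vertices. -}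

module Defs where

open import Data.Nat using (ℕ; zero; suc; _<_; _≡ᵇ_)
open import Data.Integer using (+_)
open import Data.Rational using (ℚ; 0ℚ) renaming (_/_ to _÷_)
open import Data.Fin.Subset using (Subset; ∣_∣; ⋃)
open import Data.List using (List; length)
open import Data.List.Membership.Propositional using (_∈_)
open import Data.List.Relation.Unary.All using (All)
open import Data.List.Relation.Unary.Unique.Propositional using (Unique)
open import Relation.Binary.PropositionalEquality using (_≡_)

record Hypergraph (n r : ℕ) : Set where
  field
    edges    : List (Subset n)
    distinct : Unique edges
    uniform  : All (λ E → ∣ E ∣ ≡ r) edges

open Hypergraph public

numEdges : ∀ {n r} → Hypergraph n r → ℕ
numEdges H = length (edges H)

GFree : ∀ {n r} → (v e : ℕ) → Hypergraph n r → Set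
GFree v e H =
  (S : List (Subset _)) → length S ≡ e → Unique S → All (_∈ edges H) S →
  v < ∣ ⋃ S ∣

-- natural-number division into ℚ (only used with nonzero denominators)
_//_ : ℕ → ℕ → ℚ
m // zero    = 0ℚ
m // suc k   = (+ m) ÷ suc k

toℚ : ℕ → ℚ
toℚ m = (+ m) ÷ 1

module Submission where

-- Put t₁ … t_{e-1} = p+1 (q times) followed by p (e-1-q times), so that
-- Σ tᵢ = er − v.  Starting from the edge list L₀, split Lᵢ₋₁ greedily into a
-- tᵢ-separated family Kᵢ (any two members share < tᵢ vertices) and a remainder
-- Lᵢ each of whose members meets some member of Kᵢ in ≥ tᵢ vertices.  A tᵢ-separated
-- r-uniform family has at most C(n,tᵢ)/C(r,tᵢ) members (packing lemma: no
-- tᵢ-set of vertices lies in two members).  If L_{e-1} is empty this bounds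
-- the number of edges as claimed.  Otherwise pick an edge of L_{e-1} and walk
-- back through the layers, adding at layer i a member of Kᵢ meeting the
-- current union in ≥ tᵢ vertices; this gives e distinct edges spanning at
-- most er − Σ tᵢ = v vertices, contradicting G_r(v,e)-freeness.

open import Defs
open import Data.Nat using (ℕ; _+_; _*_; _∸_; _≤_; _<_)
open import Data.Nat.Combinatorics using (_C_)
open import Data.Rational using () renaming (_≤_ to _≤ℚ_; _+_ to _+ℚ_)
open import Relation.Binary.PropositionalEquality using (_≡_)

open import Data.Nat using (zero; suc; z≤n; s≤s; s≤s⁻¹; _≤?_)
open import Data.Nat.Properties
open import Data.Nat.Combinatorics using (nCk+nC[k+1]≡[n+1]C[k+1])
open import Data.Bool using (true; false; _∧_)
open import Data.Vec using ([]; _∷_; tail)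
open import Data.List using (List; []; _∷_; length; replicate; _++_; map)
open import Data.Nat.ListAction using (sum)
open import Data.Nat.ListAction.Properties using (sum-++)
open import Data.List.Properties using (length-++; length-replicate)
open import Data.List.Membership.Propositional using (_∈_; find)
open import Data.List.Membership.Propositional.Properties using (∈-++⁺ˡ; ∈-++⁺ʳ)
open import Data.List.Relation.Unary.All as All using (All; []; _∷_)
open import Data.List.Relation.Unary.All.Properties using (¬Any⇒All¬; ++⁻ˡ; ++⁻ʳ)
open import Data.List.Relation.Unary.Any using (Any; here; there; any?)
open import Data.List.Relation.Unary.AllPairs as AllPairs using (AllPairs; []; _∷_)
import Data.List.Relation.Unary.AllPairs.Properties as AllPairsₚ
open import Data.List.Relation.Unary.Unique.Propositional using (Unique)
open import Data.List.Relation.Binary.Pointwise using (Pointwise; []; _∷_)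
open import Data.List.Relation.Binary.Permutation.Propositional using (↭-sym)
open import Data.List.Relation.Binary.Permutation.Propositional.Properties
  using (∈-resp-↭; All-resp-↭)
open import Data.List.Relation.Ternary.Interleaving.Propositional
  using (Interleaving; []; consˡ; consʳ; toPermutation)
open import Data.List.Relation.Ternary.Interleaving.Properties using (interleave-length)
open import Data.Fin.Subset using (Subset; ∣_∣; ⋃; _∪_; _∩_; _⊆_)
open import Data.Fin.Subset.Properties
  using (p⊆q⇒∣p∣≤∣q∣; x∈p∩q⁺; x∈p∩q⁻; p⊆p∪q; ∣p∣≤∣x∷p∣; ∩-comm; ∪-identityʳ)
open import Data.Product using (∃-syntax; _×_; _,_; proj₁; proj₂)
open import Data.Sum as Sum using (_⊎_; inj₁; inj₂)
open import Data.Empty using (⊥; ⊥-elim)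
open import Relation.Nullary using (yes; no)
open import Relation.Binary.PropositionalEquality
  using (refl; sym; trans; cong; cong₂; subst; subst₂; _≢_; module ≡-Reasoning)
import Data.Integer as ℤ
import Data.Integer.Properties as ℤₚ
open import Data.Rational.Unnormalised using (mkℚᵘ; _≃_; *≡*; *≤*) renaming (_+_ to _+ᵘ_)
import Data.Rational.Unnormalised.Properties as ℚᵘₚ
import Data.Rational.Properties as ℚₚ
open import Data.Rational using (toℚᵘ)

toℚᵘ-// : ∀ m k → toℚᵘ (m // suc k) ≃ mkℚᵘ (ℤ.+ m) k
toℚᵘ-// m k = ℚₚ.toℚᵘ-fromℚᵘ (mkℚᵘ (ℤ.+ m) k)

toℚ-+ : ∀ x y → toℚ (x + y) ≡ toℚ x +ℚ toℚ y
toℚ-+ x y = ℚₚ.toℚᵘ-injective (begin-equality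
  toℚᵘ (toℚ (x + y))                ≃⟨ toℚᵘ-// (x + y) 0 ⟩
  mkℚᵘ (ℤ.+ (x + y)) 0               ≃⟨ *≡* (cong (ℤ._* ℤ.+ 1) integer-sum) ⟩
  mkℚᵘ (ℤ.+ x) 0 +ᵘ mkℚᵘ (ℤ.+ y) 0  ≃⟨ ℚᵘₚ.+-cong (toℚᵘ-// x 0) (toℚᵘ-// y 0) ⟨
  toℚᵘ (toℚ x) +ᵘ toℚᵘ (toℚ y)      ≃⟨ ℚₚ.toℚᵘ-homo-+ (toℚ x) (toℚ y) ⟨
  toℚᵘ (toℚ x +ℚ toℚ y)             ∎)
  where
  open ℚᵘₚ.≤-Reasoning
  integer-sum : ℤ.+ (x + y) ≡ ℤ.+ x ℤ.* ℤ.+ 1 ℤ.+ ℤ.+ y ℤ.* ℤ.+ 1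
  integer-sum = trans (ℤₚ.pos-+ x y)
    (sym (cong₂ ℤ._+_ (ℤₚ.*-identityʳ (ℤ.+ x)) (ℤₚ.*-identityʳ (ℤ.+ y))))

toℚ≤// : ∀ x m a → 0 < a → x * a ≤ m → toℚ x ≤ℚ m // a
toℚ≤// x m (suc k) _ xa≤m = ℚₚ.toℚᵘ-cancel-≤ (begin
  toℚᵘ (toℚ x)       ≃⟨ toℚᵘ-// x 0 ⟩
  mkℚᵘ (ℤ.+ x) 0     ≤⟨ *≤* cross-multiplied ⟩
  mkℚᵘ (ℤ.+ m) k     ≃⟨ toℚᵘ-// m k ⟨
  toℚᵘ (m // suc k)  ∎)
  where
  open ℚᵘₚ.≤-Reasoning
  cross-multiplied : ℤ.+ x ℤ.* ℤ.+ suc k ℤ.≤ ℤ.+ m ℤ.* ℤ.+ 1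
  cross-multiplied = subst₂ ℤ._≤_ (ℤₚ.pos-* x (suc k)) (ℤₚ.pos-* m 1)
    (ℤ.+≤+ (≤-trans xa≤m (≤-reflexive (sym (*-identityʳ m)))))

toℚ-+≤ : ∀ x y M M′ a b → 0 < a → 0 < b → x * a ≤ M → y * b ≤ M′ →
         toℚ (x + y) ≤ℚ M // a +ℚ M′ // b
toℚ-+≤ x y M M′ a b 0<a 0<b xa≤M yb≤M′ =
  subst (_≤ℚ _) (sym (toℚ-+ x y))
    (ℚₚ.+-mono-≤ (toℚ≤// x M a 0<a xa≤M) (toℚ≤// y M′ b 0<b yb≤M′))

∣∪∣+∣∩∣ : ∀ {n} (A B : Subset n) → ∣ A ∪ B ∣ + ∣ A ∩ B ∣ ≡ ∣ A ∣ + ∣ B ∣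
∣∪∣+∣∩∣ [] [] = refl
∣∪∣+∣∩∣ (true ∷ A) (true ∷ B) = cong suc (begin
  ∣ A ∪ B ∣ + suc ∣ A ∩ B ∣  ≡⟨ +-suc ∣ A ∪ B ∣ ∣ A ∩ B ∣ ⟩
  suc (∣ A ∪ B ∣ + ∣ A ∩ B ∣) ≡⟨ cong suc (∣∪∣+∣∩∣ A B) ⟩
  suc (∣ A ∣ + ∣ B ∣)         ≡⟨ +-suc ∣ A ∣ ∣ B ∣ ⟨
  ∣ A ∣ + suc ∣ B ∣           ∎)
  where open ≡-Reasoning
∣∪∣+∣∩∣ (true ∷ A) (false ∷ B) = cong suc (∣∪∣+∣∩∣ A B)
∣∪∣+∣∩∣ (false ∷ A) (true ∷ B) = trans (cong suc (∣∪∣+∣∩∣ A B)) (sym (+-suc ∣ A ∣ ∣ B ∣))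
∣∪∣+∣∩∣ (false ∷ A) (false ∷ B) = ∣∪∣+∣∩∣ A B

∣∩∣-monoʳ : ∀ {n} (A : Subset n) {B B′ : Subset n} → B ⊆ B′ → ∣ A ∩ B ∣ ≤ ∣ A ∩ B′ ∣
∣∩∣-monoʳ A {B} B⊆B′ = p⊆q⇒∣p∣≤∣q∣ λ x∈A∩B →
  let (x∈A , x∈B) = x∈p∩q⁻ A B x∈A∩B in x∈p∩q⁺ (x∈A , B⊆B′ x∈B)

∪-growth : ∀ {n r t} (Z U : Subset n) → ∣ Z ∣ ≡ r → t ≤ ∣ Z ∩ U ∣ →
           ∣ Z ∪ U ∣ + t ≤ r + ∣ U ∣
∪-growth {t = t} Z U refl t≤∣Z∩U∣ = begin
  ∣ Z ∪ U ∣ + t          ≤⟨ +-monoʳ-≤ ∣ Z ∪ U ∣ t≤∣Z∩U∣ ⟩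
  ∣ Z ∪ U ∣ + ∣ Z ∩ U ∣  ≡⟨ ∣∪∣+∣∩∣ Z U ⟩
  ∣ Z ∣ + ∣ U ∣          ∎
  where open ≤-Reasoning

-- C(m,k) is positive for k ≤ m (needed since the bound divides by C(r,·)).
C-pos : ∀ m k → k ≤ m → 0 < m C k
C-pos m       zero    _         = s≤s z≤n
C-pos (suc m) (suc k) (s≤s k≤m) =
  subst (0 <_) (nCk+nC[k+1]≡[n+1]C[k+1] m k) (≤-trans (C-pos m k k≤m) (m≤m+n _ _))

Separated : ∀ {n} → ℕ → Subset n → Subset n → Set
Separated t A B = ∣ A ∩ B ∣ < t

-- Σ_{A ∈ K} C(|A|, t): the t-subsets of members of K, with multiplicity.
tCount : ∀ {n} → List (Subset n) → ℕ → ℕ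
tCount []      t = 0
tCount (A ∷ K) t = ∣ A ∣ C t + tCount K t

restrict : ∀ {n} → List (Subset (suc n)) → List (Subset n)
restrict = map tail

link : ∀ {n} → List (Subset (suc n)) → List (Subset n)
link []                 = []
link ((true  ∷ A) ∷ K) = A ∷ link K
link ((false ∷ A) ∷ K) = link K

-- Pascal's rule for tCount: a (t+1)-subset avoids vertex 0 or contains it.
tCount-pascal : ∀ {n} t (K : List (Subset (suc n))) →
                tCount K (suc t) ≡ tCount (restrict K) (suc t) + tCount (link K) t
tCount-pascal t [] = refl
tCount-pascal t ((false ∷ A) ∷ K) =
  trans (cong (∣ A ∣ C suc t +_) (tCount-pascal t K)) (sym (+-assoc (∣ A ∣ C suc t) _ _))
tCount-pascal t ((true ∷ A) ∷ K) =
  trans (cong₂ _+_ (sym (nCk+nC[k+1]≡[n+1]C[k+1] ∣ A ∣ t)) (tCount-pascal t K))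
        (regroup (∣ A ∣ C t) (∣ A ∣ C suc t) _ _)
  where
  regroup : ∀ a b x y → (a + b) + (x + y) ≡ (b + x) + (a + y)
  regroup = solve 4 (λ a b x y → (a :+ b) :+ (x :+ y) := (b :+ x) :+ (a :+ y)) refl
    where open import Data.Nat.Solver using (module +-*-Solver)
          open +-*-Solver

-- Deleting a vertex never enlarges intersections.
restrict-separated : ∀ {n} s (K : List (Subset (suc n))) →
                     AllPairs (Separated s) K → AllPairs (Separated s) (restrict K)
restrict-separated s K separated =
  AllPairsₚ.map⁺ (AllPairs.map (λ {A} {B} → ≤-<-trans (shrink A B)) separated)
  where
  shrink : ∀ {n} (A B : Subset (suc n)) → ∣ tail A ∩ tail B ∣ ≤ ∣ A ∩ B ∣
  shrink (a ∷ A) (b ∷ B) = ∣p∣≤∣x∷p∣ (a ∧ b) (A ∩ B)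

-- Two members through vertex 0 share it; deleting it lowers the separation by one.
link-separated : ∀ {n} t (K : List (Subset (suc n))) →
                 AllPairs (Separated (suc t)) K → AllPairs (Separated t) (link K)
link-separated t [] [] = []
link-separated t ((true ∷ A) ∷ K) (A-sep ∷ separated) =
  link-all A K A-sep ∷ link-separated t K separated
  where
  link-all : ∀ {n} (A : Subset n) K → All (Separated (suc t) (true ∷ A)) K →
             All (Separated t A) (link K)
  link-all A [] [] = []
  link-all A ((true  ∷ B) ∷ K) (AB ∷ AK) = s≤s⁻¹ AB ∷ link-all A K AK
  link-all A ((false ∷ B) ∷ K) (_  ∷ AK) = link-all A K AK
link-separated t ((false ∷ A) ∷ K) (_ ∷ separated) = link-separated t K separated

tCount-empty : ∀ t (K : List (Subset 0)) → tCount K (suc t) ≡ 0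
tCount-empty t []       = refl
tCount-empty t ([] ∷ K) = tCount-empty t K

-- Packing lemma: in a t-separated family no t-set of points lies in two
-- members, so Σ_{A ∈ K} C(|A|, t) ≤ C(n, t).  Induction on n via Pascal's rule.
packing : ∀ n t (K : List (Subset n)) → AllPairs (Separated t) K → tCount K t ≤ n C t
packing n       zero    []          _                  = z≤n
packing n       zero    (A ∷ [])    _                  = ≤-refl
packing n       zero    (A ∷ B ∷ K) ((() ∷ _) ∷ _)
packing zero    (suc t) K           _                  = ≤-reflexive (tCount-empty t K)
packing (suc n) (suc t) K           separated          = begin
  tCount K (suc t)                               ≡⟨ tCount-pascal t K ⟩
  tCount (restrict K) (suc t) + tCount (link K) t ≤⟨ +-mono-≤
    (packing n (suc t) (restrict K) (restrict-separated (suc t) K separated))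
    (packing n t (link K) (link-separated t K separated)) ⟩
  n C suc t + n C t                              ≡⟨ +-comm (n C suc t) (n C t) ⟩
  n C t + n C suc t                              ≡⟨ nCk+nC[k+1]≡[n+1]C[k+1] n t ⟩
  suc n C suc t                                  ∎
  where open ≤-Reasoning

tCount-uniform : ∀ {n r} t {K : List (Subset n)} → All (λ A → ∣ A ∣ ≡ r) K →
                 tCount K t ≡ length K * (r C t)
tCount-uniform t []               = refl
tCount-uniform t (refl ∷ uniform) = cong (_ +_) (tCount-uniform t uniform)

module _ {A : Set} {K R L : List A} (i : Interleaving K R L) where

  ∈-left : ∀ {x} → x ∈ K → x ∈ L
  ∈-left x∈K = ∈-resp-↭ (↭-sym (toPermutation i)) (∈-++⁺ˡ x∈K)

  ∈-right : ∀ {x} → x ∈ R → x ∈ L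
  ∈-right x∈R = ∈-resp-↭ (↭-sym (toPermutation i)) (∈-++⁺ʳ K x∈R)

  All-left : ∀ {P : A → Set} → All P L → All P K
  All-left all = ++⁻ˡ K (All-resp-↭ (toPermutation i) all)

  All-right : ∀ {P : A → Set} → All P L → All P R
  All-right all = ++⁻ʳ K (All-resp-↭ (toPermutation i) all)

Unique-right : ∀ {A : Set} {K R L : List A} → Interleaving K R L → Unique L → Unique R
Unique-right []        []          = []
Unique-right (consˡ i) (_ ∷ u)     = Unique-right i u
Unique-right (consʳ i) (x∉L ∷ u)   = All-right i x∉L ∷ Unique-right i u

disjoint : ∀ {A : Set} {K R L : List A} {x} → Interleaving K R L → Unique L →
           x ∈ K → x ∈ R → ⊥
disjoint (consˡ i) (x∉L ∷ _) (here refl) x∈R         = All.lookup x∉L (∈-right i x∈R) refl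
disjoint (consˡ i) (_ ∷ u)   (there x∈K) x∈R         = disjoint i u x∈K x∈R
disjoint (consʳ i) (x∉L ∷ _) x∈K         (here refl) = All.lookup x∉L (∈-left i x∈K) refl
disjoint (consʳ i) (_ ∷ u)   x∈K         (there x∈R) = disjoint i u x∈K x∈R

record Split {n} (t : ℕ) (L : List (Subset n)) : Set where
  constructor split
  field
    K R          : List (Subset n)
    interleaving : Interleaving K R L
    separated    : AllPairs (Separated t) K
    blocked      : All (λ B → Any (λ A → t ≤ ∣ B ∩ A ∣) K) R

greedy-split : ∀ {n} t (L : List (Subset n)) → Split t L
greedy-split t [] = split [] [] [] [] []
greedy-split t (B ∷ L) with greedy-split t L
... | split K R i separated blocked with any? (λ A → t ≤? ∣ B ∩ A ∣) K
...   | yes hit  = split K (B ∷ R) (consʳ i) separated (hit ∷ blocked)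
...   | no  miss = split (B ∷ K) R (consˡ i)
                     (All.map ≰⇒> (¬Any⇒All¬ K miss) ∷ separated) (All.map there blocked)

record Chain {n} (r : ℕ) (ts : List ℕ) (L : List (Subset n)) : Set where
  constructor chain
  field
    members  : List (Subset n)
    size     : length members ≡ suc (length ts)
    distinct : Unique members
    included : All (_∈ L) members
    compact  : ∣ ⋃ members ∣ + sum ts ≤ length members * r

-- A chain in the remainder of a t-split extends, by a member of the separated
-- part meeting its first member in at least t points, to a chain in L.
extend-chain : ∀ {n r t ts} {L : List (Subset n)} (s : Split t L) → Unique L →
               All (λ A → ∣ A ∣ ≡ r) L → Chain r ts (Split.R s) → Chain r (t ∷ ts) L
extend-chain {n} {r} {t} {ts} (split K R i _ blocked) unique uniform
             (chain (B ∷ T) size distinct included compact) =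
  chain (A ∷ B ∷ T) (cong suc size) (fresh ∷ distinct)
        (∈-left i A∈K ∷ All.map (∈-right i) included) compact′
  where
  U : Subset n
  U = ⋃ (B ∷ T)

  witness : ∃[ A ] A ∈ K × t ≤ ∣ B ∩ A ∣
  witness = find (All.lookup blocked (All.head included))

  A : Subset n
  A = proj₁ witness

  A∈K : A ∈ K
  A∈K = proj₁ (proj₂ witness)

  fresh : All (A ≢_) (B ∷ T)
  fresh = All.map (λ C∈R A≡C → disjoint i unique A∈K (subst (_∈ R) (sym A≡C) C∈R)) included

  t≤∣A∩U∣ : t ≤ ∣ A ∩ U ∣
  t≤∣A∩U∣ = begin
    t              ≤⟨ proj₂ (proj₂ witness) ⟩
    ∣ B ∩ A ∣      ≡⟨ cong ∣_∣ (∩-comm B A) ⟩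
    ∣ A ∩ B ∣      ≤⟨ ∣∩∣-monoʳ A (p⊆p∪q (⋃ T)) ⟩
    ∣ A ∩ U ∣      ∎
    where open ≤-Reasoning

  compact′ : ∣ A ∪ U ∣ + (t + sum ts) ≤ r + length (B ∷ T) * r
  compact′ = begin
    ∣ A ∪ U ∣ + (t + sum ts)  ≡⟨ +-assoc ∣ A ∪ U ∣ t (sum ts) ⟨
    ∣ A ∪ U ∣ + t + sum ts    ≤⟨ +-monoˡ-≤ (sum ts)
                                   (∪-growth A U (All.lookup uniform (∈-left i A∈K)) t≤∣A∩U∣) ⟩
    r + ∣ U ∣ + sum ts        ≡⟨ +-assoc r ∣ U ∣ (sum ts) ⟩
    r + (∣ U ∣ + sum ts)      ≤⟨ +-monoʳ-≤ r compact ⟩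
    r + length (B ∷ T) * r    ∎
    where open ≤-Reasoning

-- k sets fit at threshold t when k C(r,t) ≤ C(n,t), the packing bound.
Fits : ℕ → ℕ → ℕ → ℕ → Set
Fits n r k t = k * (r C t) ≤ n C t

layers : ∀ n r ts (L : List (Subset n)) → Unique L → All (λ A → ∣ A ∣ ≡ r) L →
         ∃[ ks ] Pointwise (Fits n r) ks ts × (length L ≡ sum ks ⊎ Chain r ts L)
layers n r [] [] _ _ = [] , [] , inj₁ refl
layers n r [] (A ∷ L) _ (∣A∣≡r ∷ _) =
  [] , [] , inj₂ (chain (A ∷ []) refl ([] ∷ []) (here refl ∷ []) single)
  where
  single : ∣ ⋃ (A ∷ []) ∣ + 0 ≤ 1 * r
  single = ≤-reflexive (cong (_+ 0) (trans (cong ∣_∣ (∪-identityʳ A)) ∣A∣≡r))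
layers n r (t ∷ ts) L unique uniform with greedy-split t L
... | s@(split K R i separated _) with layers n r ts R (Unique-right i unique) (All-right i uniform)
...   | ks , fits , outcome =
  length K ∷ ks , K-fits ∷ fits , Sum.map covered (extend-chain s unique uniform) outcome
  where
  K-fits : Fits n r (length K) t
  K-fits = subst (_≤ n C t) (tCount-uniform t (All-left i uniform)) (packing n t K separated)
  covered : length R ≡ sum ks → length L ≡ length K + sum ks
  covered R≡ks = trans (interleave-length i) (cong (length K +_) R≡ks)

sum-replicate : ∀ k a → sum (replicate k a) ≡ k * a
sum-replicate zero    a = refl
sum-replicate (suc k) a = cong (a +_) (sum-replicate k a)

replicate-fits : ∀ {n r t} q {ks} → Pointwise (Fits n r) ks (replicate q t) →
                 sum ks * (r C t) ≤ q * (n C t)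
replicate-fits zero [] = z≤n
replicate-fits {n} {r} {t} (suc q) {k ∷ ks} (k-fits ∷ fits) = begin
  (k + sum ks) * (r C t)          ≡⟨ *-distribʳ-+ (r C t) k (sum ks) ⟩
  k * (r C t) + sum ks * (r C t)  ≤⟨ +-mono-≤ k-fits (replicate-fits q fits) ⟩
  n C t + q * (n C t)             ∎
  where open ≤-Reasoning

Pointwise-++⁻ : ∀ {A B : Set} {R : A → B → Set} (xs : List B) {ys ks} →
                Pointwise R ks (xs ++ ys) →
                ∃[ ks₁ ] ∃[ ks₂ ] ks ≡ ks₁ ++ ks₂ × Pointwise R ks₁ xs × Pointwise R ks₂ ys
Pointwise-++⁻ []       related       = [] , _ , refl , [] , related
Pointwise-++⁻ (x ∷ xs) (k∼x ∷ related) with Pointwise-++⁻ xs related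
... | ks₁ , ks₂ , refl , related₁ , related₂ = _ ∷ ks₁ , ks₂ , refl , k∼x ∷ related₁ , related₂

thresholds : ℕ → ℕ → ℕ → List ℕ
thresholds p q m = replicate q (p + 1) ++ replicate m p

-- With q + m = e − 1 there are e − 1 thresholds ...
length-thresholds : ∀ p q m → length (thresholds p q m) ≡ q + m
length-thresholds p q m =
  trans (length-++ (replicate q (p + 1))) (cong₂ _+_ (length-replicate q) (length-replicate m))

-- ... and they sum to p(e − 1) + q = er − v.
sum-thresholds : ∀ p q m → sum (thresholds p q m) ≡ p * (q + m) + q
sum-thresholds p q m = begin
  sum (thresholds p q m)                            ≡⟨ sum-++ (replicate q (p + 1)) _ ⟩
  sum (replicate q (p + 1)) + sum (replicate m p)   ≡⟨ cong₂ _+_ (sum-replicate q (p + 1))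
                                                                 (sum-replicate m p) ⟩
  q * (p + 1) + m * p                               ≡⟨ expand p q m ⟩
  p * (q + m) + q                                   ∎
  where
  open ≡-Reasoning
  expand : ∀ p q m → q * (p + 1) + m * p ≡ p * (q + m) + q
  expand = solve 3 (λ p q m → q :* (p :+ con 1) :+ m :* p := p :* (q :+ m) :+ q) refl
    where open import Data.Nat.Solver using (module +-*-Solver)
          open +-*-Solver

layers-bound : ∀ {n r} p q m {ks} → p + 1 ≤ r → Pointwise (Fits n r) ks (thresholds p q m) →
  toℚ (sum ks) ≤ℚ ((q * (n C (p + 1))) // (r C (p + 1)) +ℚ (m * (n C p)) // (r C p))
layers-bound {n} {r} p q m p+1≤r fits with Pointwise-++⁻ (replicate q (p + 1)) fits
... | ks₁ , ks₂ , refl , fits₁ , fits₂ =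
  subst (λ x → toℚ x ≤ℚ _) (sym (sum-++ ks₁ ks₂))
    (toℚ-+≤ (sum ks₁) (sum ks₂) (q * (n C (p + 1))) (m * (n C p)) (r C (p + 1)) (r C p)
      (C-pos r (p + 1) p+1≤r) (C-pos r p (≤-trans (m≤m+n p 1) p+1≤r))
      (replicate-fits q fits₁) (replicate-fits m fits₂))

chain-bound : ∀ {n r v e ts} (H : Hypergraph n r) → GFree v e H →
              Chain r ts (edges H) → suc (length ts) ≡ e → v + sum ts < e * r
chain-bound {r = r} {v} {ts = ts} H free (chain S size distinct included compact) refl =
  begin-strict
    v + sum ts            <⟨ +-monoˡ-< (sum ts) (free S size distinct included) ⟩
    ∣ ⋃ S ∣ + sum ts      ≤⟨ compact ⟩
    length S * r          ≡⟨ cong (_* r) size ⟩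
    suc (length ts) * r   ∎
  where open ≤-Reasoning

theorem7 : (n r v e p q : ℕ) → 0 < n → 0 < r → 0 < v → 2 ≤ e →
    e * r ≡ v + p * (e ∸ 1) + q → 1 ≤ q → q ≤ e ∸ 1 → p + 1 ≤ r →
    (H : Hypergraph n r) → GFree v e H →
    toℚ (numEdges H) ≤ℚ
      ((q * (n C (p + 1))) // (r C (p + 1)) +ℚ ((e ∸ 1 ∸ q) * (n C p)) // (r C p))
-- The hypothesis 2 ≤ e rules out e = 0; write e = e′ + 1 and peel e′ layers.
theorem7 n r v (suc e′) p q _ _ _ _ er≡ _ q≤e′ p+1≤r H free
  with layers n r (thresholds p q (e′ ∸ q)) (edges H) (distinct H) (uniform H)
... | ks , fits , inj₁ |H|≡Σks =
  subst (λ x → toℚ x ≤ℚ _) (sym |H|≡Σks) (layers-bound p q (e′ ∸ q) p+1≤r fits)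
... | _ , _ , inj₂ c =
  ⊥-elim (<-irrefl budget (chain-bound H free c (cong suc length≡e′)))
  where
  length≡e′ : length (thresholds p q (e′ ∸ q)) ≡ e′
  length≡e′ = trans (length-thresholds p q (e′ ∸ q)) (m+[n∸m]≡n q≤e′)
  budget : v + sum (thresholds p q (e′ ∸ q)) ≡ suc e′ * r
  budget = begin
    v + sum (thresholds p q (e′ ∸ q))  ≡⟨ cong (v +_) (sum-thresholds p q (e′ ∸ q)) ⟩
    v + (p * (q + (e′ ∸ q)) + q)       ≡⟨ cong (λ m → v + (p * m + q)) (m+[n∸m]≡n q≤e′) ⟩
    v + (p * e′ + q)                   ≡⟨ +-assoc v (p * e′) q ⟨
    v + p * e′ + q                     ≡⟨ er≡ ⟨
    suc e′ * r                         ∎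
    where open ≡-Reasoning
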